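{- Let $\mathbb{F}$ be a finite field of order $q$ with $\mathrm{char}(\mathbb{F})\neq 2$, and let $g$ be a two-dimensional subspace of $\mathbb{F}^4$. Then $g$ generates a linear sudoku square $M_g$ of parallel type (unique up to relabeling of symbols) if and only if $g$ has trivial intersection with each of the subspaces $g_c=\langle (1,0,0,0),(0,1,0,0)\rangle$, $g_r=\langle (0,0,1,0),(0,0,0,1)\rangle$ and $g_{ss}=\langle (0,1,0,0),(0,0,0,1)\rangle$.
   Context: A sudoku square of order $n^2$ is a latin square of order $n^2$ (an $n^2\times n^2$ array filled with $n^2$ symbols, each symbol occurring exactly once in each row and each column) such that, when the array is partitioned into $n\times n$ subsquares in the natural way, each subsquare contains every symbol. Locations of an array of order $q^2$ are identified with vectors $(x_1,x_2,x_3,x_4)\in\mathbb{F}^4$: $x_1$ is the large row (which horizontal band of $q$ subsquares), $x_2$ the mini row (which row within that band), $x_3$ the large column, and $x_4$ the mini column; thus the row of the location is determined by $(x_1,x_2)$, its column by $(x_3,x_4)$, and its subsquare by $(x_1,x_3)$ (elements of $\mathbb{F}$ are used as labels via a fixed ordering of $\mathbb{F}$). For a two-dimensional subspace $g\subseteq\mathbb{F}^4$, the array $M_g$ is obtained by assigning to the locations in each coset $x+g$ of $g$ a common symbol, with distinct cosets receiving distinct symbols ($q^2$ symbols in all). We say $g$ generates a linear sudoku square of parallel type if $M_g$ is a sudoku square (so the set of locations of each symbol is a coset of the single subspace $g$). -}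

module Defs where

open import Level using (Level; _⊔_) renaming (suc to lsuc)
open import Relation.Binary.PropositionalEquality using (_≡_)
open import Data.Nat using (ℕ)
open import Data.Fin using (Fin; zero; suc)
open import Data.Product using (Σ; _×_; _,_; ∃)
open import Relation.Nullary using (¬_)
open import Function.Bundles using (_⇔_)
open import Algebra.Bundles using (CommutativeRing)

record Field (c ℓ : Level) : Set (lsuc (c ⊔ ℓ)) where
  field
    commutativeRing : CommutativeRing c ℓ
  open CommutativeRing commutativeRing public
  field
    1≉0     : ¬ (1# ≈ 0#)
    inverse : ∀ x → ¬ (x ≈ 0#) → Σ Carrier λ y → (x * y) ≈ 1#

module FieldTheory {c ℓ : Level} (F : Field c ℓ) where
  open Field F

  HasOrder : ℕ → Set (c ⊔ ℓ)
  HasOrder q = Σ (Fin q → Carrier) λ e →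
                 (∀ i j → e i ≈ e j → i ≡ j) × (∀ x → Σ (Fin q) λ i → e i ≈ x)

  CharNot2 : Set ℓ
  CharNot2 = ¬ ((1# + 1#) ≈ 0#)

  -- Vectors of F⁴ : a location (x₁,x₂,x₃,x₄) =
  -- (large row, mini row, large column, mini column).
  V4 : Set c
  V4 = Fin 4 → Carrier

  vec : Carrier → Carrier → Carrier → Carrier → V4
  vec a b c' d zero = a
  vec a b c' d (suc zero) = b
  vec a b c' d (suc (suc zero)) = c'
  vec a b c' d (suc (suc (suc zero))) = d

  _≈v_ : V4 → V4 → Set ℓ
  x ≈v y = ∀ i → x i ≈ y i

  _+v_ : V4 → V4 → V4
  (x +v y) i = x i + y i

  _-v_ : V4 → V4 → V4
  (x -v y) i = x i + (- y i)

  _·v_ : Carrier → V4 → V4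
  (a ·v x) i = a * x i

  0v : V4
  0v i = 0#

  InSpan : V4 → V4 → V4 → Set (c ⊔ ℓ)
  InSpan u v x = Σ Carrier λ a → Σ Carrier λ b → x ≈v ((a ·v u) +v (b ·v v))

  LinIndep : V4 → V4 → Set (c ⊔ ℓ)
  LinIndep u v = ∀ a b → ((a ·v u) +v (b ·v v)) ≈v 0v → (a ≈ 0#) × (b ≈ 0#)

  TrivialIntersection : V4 → V4 → V4 → V4 → Set (c ⊔ ℓ)
  TrivialIntersection u v u' v' = ∀ x → InSpan u v x → InSpan u' v' x → x ≈v 0v

  e₁ e₂ e₃ e₄ : V4
  e₁ = vec 1# 0# 0# 0#
  e₂ = vec 0# 1# 0# 0#
  e₃ = vec 0# 0# 1# 0#
  e₄ = vec 0# 0# 0# 1#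

  ExactlyOne₂ : (Carrier → Carrier → Set (c ⊔ ℓ)) → Set (c ⊔ ℓ)
  ExactlyOne₂ P = Σ Carrier λ s → Σ Carrier λ t → P s t ×
                    (∀ s' t' → P s' t' → (s ≈ s') × (t ≈ t'))

  -- M_g for g = ⟨u , v⟩: location x carries the symbol x + g.  Location x
  -- carries the same symbol as location y iff x - y ∈ g.
  SameSymbol : V4 → V4 → V4 → V4 → Set (c ⊔ ℓ)
  SameSymbol u v x y = InSpan u v (x -v y)

  -- M_g is a sudoku square: every symbol (the symbol y + g of some location y)
  -- occurs exactly once in each row (x₁,x₂), each column (x₃,x₄) and each
  -- subsquare (x₁,x₃).
  GeneratesSudoku : V4 → V4 → Set (c ⊔ ℓ)
  GeneratesSudoku u v =
      (∀ y a b → ExactlyOne₂ λ s t → SameSymbol u v (vec a b s t) y)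
    × (∀ y s t → ExactlyOne₂ λ a b → SameSymbol u v (vec a b s t) y)
    × (∀ y a s → ExactlyOne₂ λ b t → SameSymbol u v (vec a b s t) y)

-- Rows, columns and subsquares are three families of regions; a region is
-- the set of locations with two prescribed coordinates, i.e. a coset of the
-- span ⟨e_k , e_l⟩ of the two remaining unit vectors.  Two locations of a
-- region carry the same symbol iff their difference lies in g ∩ ⟨e_k , e_l⟩,
-- so symbols are never repeated within a region iff that intersection is
-- trivial.  Each symbol then also occurs in every region: the coordinate
-- projection g → F² onto the two prescribed coordinates is injective, hence
-- (being a map between planes) surjective, so every coset of g meets every
-- region.

module Submission where

open import Defs
open import Level using (_⊔_)
open import Algebra.Bundles using (CommutativeRing)
import Algebra.Properties.AbelianGroup as AbelianGroupProperties
import Algebra.Properties.CommutativeSemigroup as CommutativeSemigroupProperties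
import Algebra.Properties.Ring as RingProperties
import Algebra.Solver.Ring.NaturalCoefficients.Default as NaturalCoefficientSolver
open import Data.Fin using (Fin; zero; suc; #_)
open import Data.Nat using (ℕ)
open import Data.Product using (Σ; _×_; _,_; proj₁; proj₂)
open import Function.Bundles using (_⇔_; mk⇔; module Equivalence)
open import Relation.Nullary using (¬_)
import Relation.Binary.Reasoning.Setoid as SetoidReasoning

module CommutativeRingLemmas {c ℓ} (R : CommutativeRing c ℓ) where
  open CommutativeRing R
  open RingProperties ring using ([y-z]x≈yx-zx; -‿distribˡ-*)
  open AbelianGroupProperties +-abelianGroup using (⁻¹-∙-comm; ⁻¹-injective; ε⁻¹≈ε)
  open CommutativeSemigroupProperties +-commutativeSemigroup using (interchange)
  open NaturalCoefficientSolver commutativeSemiring using (solve; _:=_; _:+_; _:*_)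
  open SetoidReasoning setoid

  -x≈0⇒x≈0 : ∀ {x} → - x ≈ 0# → x ≈ 0#
  -x≈0⇒x≈0 -x≈0 = ⁻¹-injective (trans -x≈0 (sym ε⁻¹≈ε))

  xy-yx≈0 : ∀ x y → x * y + (- y) * x ≈ 0#
  xy-yx≈0 x y = begin
    x * y + (- y) * x    ≈⟨ +-congˡ (sym (-‿distribˡ-* y x)) ⟩
    x * y + - (y * x)    ≈⟨ +-congˡ (-‿cong (*-comm y x)) ⟩
    x * y + - (x * y)    ≈⟨ -‿inverseʳ (x * y) ⟩
    0#                   ∎

  ax+by≈0 : ∀ a b {x y} → x ≈ 0# → y ≈ 0# → a * x + b * y ≈ 0#
  ax+by≈0 a b {x} {y} x≈0 y≈0 = begin
    a * x + b * y     ≈⟨ +-cong (*-congˡ x≈0) (*-congˡ y≈0) ⟩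
    a * 0# + b * 0#   ≈⟨ +-cong (zeroʳ a) (zeroʳ b) ⟩
    0# + 0#           ≈⟨ +-identityʳ 0# ⟩
    0#                ∎

  ax+by≈a : ∀ a b {x y} → x ≈ 1# → y ≈ 0# → a * x + b * y ≈ a
  ax+by≈a a b {x} {y} x≈1 y≈0 = begin
    a * x + b * y     ≈⟨ +-cong (*-congˡ x≈1) (*-congˡ y≈0) ⟩
    a * 1# + b * 0#   ≈⟨ +-cong (*-identityʳ a) (zeroʳ b) ⟩
    a + 0#            ≈⟨ +-identityʳ a ⟩
    a                 ∎

  ax+by≈b : ∀ a b {x y} → x ≈ 0# → y ≈ 1# → a * x + b * y ≈ b
  ax+by≈b a b {x} {y} x≈0 y≈1 = begin
    a * x + b * y     ≈⟨ +-comm _ _ ⟩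
    b * y + a * x     ≈⟨ ax+by≈a b a y≈1 x≈0 ⟩
    b                 ∎

  0x+0y≈0 : ∀ {a b} x y → a ≈ 0# → b ≈ 0# → a * x + b * y ≈ 0#
  0x+0y≈0 x y a≈0 b≈0 = trans (+-cong (*-comm _ x) (*-comm _ y)) (ax+by≈0 x y a≈0 b≈0)

  [x-z]-[y-z]≈x-y : ∀ x y z → (x - z) - (y - z) ≈ x - y
  [x-z]-[y-z]≈x-y x y z = begin
    (x - z) - (y - z)           ≈⟨ +-congˡ (sym (⁻¹-∙-comm y (- z))) ⟩
    (x + - z) + (- y + - - z)   ≈⟨ interchange x (- z) (- y) (- - z) ⟩
    (x - y) + (- z + - - z)     ≈⟨ +-congˡ (-‿inverseʳ (- z)) ⟩
    (x - y) + 0#                ≈⟨ +-identityʳ (x - y) ⟩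
    x - y                       ∎

  [ax+by]-[a'x+b'y]≈[a-a']x+[b-b']y : ∀ a b a' b' x y →
    (a * x + b * y) - (a' * x + b' * y) ≈ (a - a') * x + (b - b') * y
  [ax+by]-[a'x+b'y]≈[a-a']x+[b-b']y a b a' b' x y = begin
    (a * x + b * y) - (a' * x + b' * y)          ≈⟨ +-congˡ (sym (⁻¹-∙-comm (a' * x) (b' * y))) ⟩
    (a * x + b * y) + (- (a' * x) + - (b' * y))  ≈⟨ interchange (a * x) (b * y) _ _ ⟩
    (a * x - a' * x) + (b * y - b' * y)          ≈⟨ sym (+-cong ([y-z]x≈yx-zx x a a') ([y-z]x≈yx-zx y b b')) ⟩
    (a - a') * x + (b - b') * y                  ∎

  *+*-linear : ∀ x y α β α' β' a c →
    (x * α + y * α') * a + (x * β + y * β') * c ≈ x * (α * a + β * c) + y * (α' * a + β' * c)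
  *+*-linear = solve 8 (λ x y α β α' β' a c →
    (x :* α :+ y :* α') :* a :+ (x :* β :+ y :* β') :* c
      := x :* (α :* a :+ β :* c) :+ y :* (α' :* a :+ β' :* c)) refl

module PlaneLinearAlgebra {c ℓ} (F : Field c ℓ) where
  open Field F
  open RingProperties ring using (-‿distribˡ-*)
  open CommutativeRingLemmas commutativeRing
  open SetoidReasoning setoid

  Independent₂ : Carrier → Carrier → Carrier → Carrier → Set (c ⊔ ℓ)
  Independent₂ a b c' d =
    ∀ α β → α * a + β * c' ≈ 0# → α * b + β * d ≈ 0# → (α ≈ 0#) × (β ≈ 0#)

  -- The adjugate columns (d , - b) and (- c' , a) are sent to (det , 0) and
  -- (0 , det); independence forces det ≉ 0, and rescaling them by det⁻¹
  -- gives preimages of the unit vectors.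
  independent₂⇒spanning : ∀ {a b c' d} → Independent₂ a b c' d → ∀ p q →
    Σ Carrier λ α → Σ Carrier λ β → (α * a + β * c' ≈ p) × (α * b + β * d ≈ q)
  independent₂⇒spanning {a} {b} {c'} {d} independent p q = α , β , first , second
    where
    det : Carrier
    det = a * d - b * c'

    adj₁-first : d * a + (- b) * c' ≈ det
    adj₁-first = +-cong (*-comm d a) (sym (-‿distribˡ-* b c'))

    adj₂-second : (- c') * b + a * d ≈ det
    adj₂-second = trans (+-comm _ _)
      (+-congˡ (trans (sym (-‿distribˡ-* c' b)) (-‿cong (*-comm c' b))))

    adj₁-second : d * b + (- b) * d ≈ 0#
    adj₁-second = xy-yx≈0 d b

    adj₂-first : (- c') * a + a * c' ≈ 0#
    adj₂-first = trans (+-comm _ _) (xy-yx≈0 a c')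

    det≉0 : ¬ (det ≈ 0#)
    det≉0 det≈0 = 1≉0 (proj₁ (independent 1# 0# (unit-image≈0 c' a≈0) (unit-image≈0 d b≈0)))
      where
      b≈0 : b ≈ 0#
      b≈0 = -x≈0⇒x≈0 (proj₂ (independent d (- b) (trans adj₁-first det≈0) adj₁-second))
      a≈0 : a ≈ 0#
      a≈0 = proj₂ (independent (- c') a adj₂-first (trans adj₂-second det≈0))
      unit-image≈0 : ∀ {x} y → x ≈ 0# → 1# * x + 0# * y ≈ 0#
      unit-image≈0 {x} y x≈0 =
        trans (+-cong (trans (*-identityˡ x) x≈0) (zeroˡ y)) (+-identityʳ 0#)

    det⁻¹ : Carrier
    det⁻¹ = proj₁ (inverse det det≉0)

    rescale : ∀ r → (det⁻¹ * r) * det ≈ r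
    rescale r = begin
      (det⁻¹ * r) * det   ≈⟨ *-assoc det⁻¹ r det ⟩
      det⁻¹ * (r * det)   ≈⟨ *-congˡ (*-comm r det) ⟩
      det⁻¹ * (det * r)   ≈⟨ sym (*-assoc det⁻¹ det r) ⟩
      (det⁻¹ * det) * r   ≈⟨ *-congʳ (trans (*-comm det⁻¹ det) (proj₂ (inverse det det≉0))) ⟩
      1# * r              ≈⟨ *-identityˡ r ⟩
      r                   ∎

    x y α β : Carrier
    x = det⁻¹ * p
    y = det⁻¹ * q
    α = x * d + y * (- c')
    β = x * (- b) + y * a

    first : α * a + β * c' ≈ p
    first = begin
      α * a + β * c'                                   ≈⟨ *+*-linear x y d (- b) (- c') a a c' ⟩
      x * (d * a + (- b) * c') + y * ((- c') * a + a * c') ≈⟨ +-cong (*-congˡ adj₁-first) (*-congˡ adj₂-first) ⟩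
      x * det + y * 0#                                 ≈⟨ +-cong (rescale p) (zeroʳ y) ⟩
      p + 0#                                           ≈⟨ +-identityʳ p ⟩
      p                                                ∎

    second : α * b + β * d ≈ q
    second = begin
      α * b + β * d                                    ≈⟨ *+*-linear x y d (- b) (- c') a b d ⟩
      x * (d * b + (- b) * d) + y * ((- c') * b + a * d) ≈⟨ +-cong (*-congˡ adj₁-second) (*-congˡ adj₂-second) ⟩
      x * 0# + y * det                                 ≈⟨ +-cong (zeroʳ x) (rescale q) ⟩
      0# + q                                           ≈⟨ +-identityˡ q ⟩
      q                                                ∎

module LinearSudoku {c ℓ} (F : Field c ℓ) where
  open Field F
  open FieldTheory F
  open AbelianGroupProperties +-abelianGroup using (xyx⁻¹≈y; x∙y⁻¹≈ε⇒x≈y; ε⁻¹≈ε)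
  open CommutativeRingLemmas commutativeRing
  open PlaneLinearAlgebra F

  record Regions : Set (c ⊔ ℓ) where
    field
      place : Carrier → Carrier → Carrier → Carrier → V4
      fixed₁ fixed₂ free₁ free₂ : Fin 4
      place-fixed₁ : ∀ p q s t → place p q s t fixed₁ ≈ p
      place-fixed₂ : ∀ p q s t → place p q s t fixed₂ ≈ q
      place-free₁ : ∀ p q s t → place p q s t free₁ ≈ s
      place-free₂ : ∀ p q s t → place p q s t free₂ ≈ t
      ≈v-by-coordinates : ∀ {x y} → x fixed₁ ≈ y fixed₁ → x fixed₂ ≈ y fixed₂ →
        x free₁ ≈ y free₁ → x free₂ ≈ y free₂ → x ≈v y

    direction₁ direction₂ : V4
    direction₁ = place 0# 0# 1# 0#
    direction₂ = place 0# 0# 0# 1#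

  EachSymbolOnceIn : Regions → V4 → V4 → Set (c ⊔ ℓ)
  EachSymbolOnceIn R u v =
    ∀ y p q → ExactlyOne₂ λ s t → SameSymbol u v (Regions.place R p q s t) y

  ≈v-by-components : ∀ {x y} → x (# 0) ≈ y (# 0) → x (# 1) ≈ y (# 1) →
    x (# 2) ≈ y (# 2) → x (# 3) ≈ y (# 3) → x ≈v y
  ≈v-by-components h₀ h₁ h₂ h₃ = λ where
    zero → h₀
    (suc zero) → h₁
    (suc (suc zero)) → h₂
    (suc (suc (suc zero))) → h₃

  rows columns boxes : Regions
  rows = record
    { place = vec
    ; fixed₁ = # 0 ; fixed₂ = # 1 ; free₁ = # 2 ; free₂ = # 3
    ; place-fixed₁ = λ _ _ _ _ → refl ; place-fixed₂ = λ _ _ _ _ → refl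
    ; place-free₁ = λ _ _ _ _ → refl ; place-free₂ = λ _ _ _ _ → refl
    ; ≈v-by-coordinates = λ h₀ h₁ h₂ h₃ → ≈v-by-components h₀ h₁ h₂ h₃
    }
  columns = record
    { place = λ p q s t → vec s t p q
    ; fixed₁ = # 2 ; fixed₂ = # 3 ; free₁ = # 0 ; free₂ = # 1
    ; place-fixed₁ = λ _ _ _ _ → refl ; place-fixed₂ = λ _ _ _ _ → refl
    ; place-free₁ = λ _ _ _ _ → refl ; place-free₂ = λ _ _ _ _ → refl
    ; ≈v-by-coordinates = λ h₂ h₃ h₀ h₁ → ≈v-by-components h₀ h₁ h₂ h₃
    }
  boxes = record
    { place = λ p q s t → vec p s q t
    ; fixed₁ = # 0 ; fixed₂ = # 2 ; free₁ = # 1 ; free₂ = # 3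
    ; place-fixed₁ = λ _ _ _ _ → refl ; place-fixed₂ = λ _ _ _ _ → refl
    ; place-free₁ = λ _ _ _ _ → refl ; place-free₂ = λ _ _ _ _ → refl
    ; ≈v-by-coordinates = λ h₀ h₂ h₁ h₃ → ≈v-by-components h₀ h₁ h₂ h₃
    }

  ExactlyOne₂-unique : ∀ {P s t s' t'} → ExactlyOne₂ P → P s t → P s' t' → (s ≈ s') × (t ≈ t')
  ExactlyOne₂-unique (_ , _ , _ , unique) Pst Ps't' =
    trans (sym (proj₁ (unique _ _ Pst))) (proj₁ (unique _ _ Ps't')) ,
    trans (sym (proj₂ (unique _ _ Pst))) (proj₂ (unique _ _ Ps't'))

  module _ {u v : V4} where

    InSpan-resp-≈v : ∀ {x x'} → x ≈v x' → InSpan u v x → InSpan u v x'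
    InSpan-resp-≈v x≈x' (α , β , x∈g) = α , β , λ m → trans (sym (x≈x' m)) (x∈g m)

    InSpan-0v : ∀ {x} → x ≈v 0v → InSpan u v x
    InSpan-0v x≈0 = 0# , 0# , λ m → trans (x≈0 m) (sym (0x+0y≈0 (u m) (v m) refl refl))

    InSpan⇒SameSymbol-0v : ∀ {x} → InSpan u v x → SameSymbol u v x 0v
    InSpan⇒SameSymbol-0v = InSpan-resp-≈v λ m → sym (trans (+-congˡ ε⁻¹≈ε) (+-identityʳ _))

    sameSymbol-euclidean : ∀ {x x' y} → SameSymbol u v x y → SameSymbol u v x' y →
      SameSymbol u v x x'
    sameSymbol-euclidean {x} {x'} {y} (α , β , x∈y+g) (α' , β' , x'∈y+g) =
      α - α' , β - β' , λ m → begin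
        x m - x' m                                   ≈⟨ [x-z]-[y-z]≈x-y (x m) (x' m) (y m) ⟨
        (x m - y m) - (x' m - y m)                   ≈⟨ +-cong (x∈y+g m) (-‿cong (x'∈y+g m)) ⟩
        (α * u m + β * v m) - (α' * u m + β' * v m)  ≈⟨ [ax+by]-[a'x+b'y]≈[a-a']x+[b-b']y α β α' β' (u m) (v m) ⟩
        (α - α') * u m + (β - β') * v m              ∎
      where open SetoidReasoning setoid

  module _ (R : Regions) where
    open Regions R

    in-directions : ∀ {z} s t → z fixed₁ ≈ 0# → z fixed₂ ≈ 0# → z free₁ ≈ s → z free₂ ≈ t →
      z ≈v ((s ·v direction₁) +v (t ·v direction₂))
    in-directions s t z₁≈0 z₂≈0 z₃≈s z₄≈t = ≈v-by-coordinates
      (trans z₁≈0 (sym (ax+by≈0 s t (place-fixed₁ 0# 0# 1# 0#) (place-fixed₁ 0# 0# 0# 1#))))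
      (trans z₂≈0 (sym (ax+by≈0 s t (place-fixed₂ 0# 0# 1# 0#) (place-fixed₂ 0# 0# 0# 1#))))
      (trans z₃≈s (sym (ax+by≈a s t (place-free₁ 0# 0# 1# 0#) (place-free₁ 0# 0# 0# 1#))))
      (trans z₄≈t (sym (ax+by≈b s t (place-free₂ 0# 0# 1# 0#) (place-free₂ 0# 0# 0# 1#))))

    module _ {u v : V4} (g∩directions : TrivialIntersection u v direction₁ direction₂) where

      vanishing-on-fixed⇒0v : ∀ {z} → InSpan u v z → z fixed₁ ≈ 0# → z fixed₂ ≈ 0# → z ≈v 0v
      vanishing-on-fixed⇒0v {z} z∈g z₁≈0 z₂≈0 =
        g∩directions z z∈g (z free₁ , z free₂ , in-directions _ _ z₁≈0 z₂≈0 refl refl)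

      fixed-coordinates-independent : LinIndep u v →
        Independent₂ (u fixed₁) (u fixed₂) (v fixed₁) (v fixed₂)
      fixed-coordinates-independent independent α β z₁≈0 z₂≈0 =
        independent α β (vanishing-on-fixed⇒0v (α , β , λ _ → refl) z₁≈0 z₂≈0)

      sameSymbol-cell : ∀ y p q α β → let g = (α ·v u) +v (β ·v v) in
        g fixed₁ ≈ p - y fixed₁ → g fixed₂ ≈ q - y fixed₂ →
        SameSymbol u v (place p q (y free₁ + g free₁) (y free₂ + g free₂)) y
      sameSymbol-cell y p q α β g₁≈ g₂≈ = α , β , ≈v-by-coordinates
        (trans (+-congʳ (place-fixed₁ p q _ _)) (sym g₁≈))
        (trans (+-congʳ (place-fixed₂ p q _ _)) (sym g₂≈))
        (trans (+-congʳ (place-free₁ p q _ _)) (xyx⁻¹≈y (y free₁) _))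
        (trans (+-congʳ (place-free₂ p q _ _)) (xyx⁻¹≈y (y free₂) _))

      symbol-occurs : LinIndep u v → ∀ y p q →
        Σ Carrier λ s → Σ Carrier λ t → SameSymbol u v (place p q s t) y
      symbol-occurs independent y p q =
        let α , β , g₁≈ , g₂≈ = independent₂⇒spanning (fixed-coordinates-independent independent)
                                  (p - y fixed₁) (q - y fixed₂)
        in _ , _ , sameSymbol-cell y p q α β g₁≈ g₂≈

      symbol-unique : ∀ {y p q s t s' t'} → SameSymbol u v (place p q s t) y →
        SameSymbol u v (place p q s' t') y → (s ≈ s') × (t ≈ t')
      symbol-unique {y} {p} {q} {s} {t} {s'} {t'} same same' =
        x∙y⁻¹≈ε⇒x≈y s s' (difference-at free₁ place-free₁) ,
        x∙y⁻¹≈ε⇒x≈y t t' (difference-at free₂ place-free₂)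
        where
        difference≈0 : (place p q s t -v place p q s' t') ≈v 0v
        difference≈0 = vanishing-on-fixed⇒0v (sameSymbol-euclidean same same')
          (trans (+-cong (place-fixed₁ p q s t) (-‿cong (place-fixed₁ p q s' t'))) (-‿inverseʳ p))
          (trans (+-cong (place-fixed₂ p q s t) (-‿cong (place-fixed₂ p q s' t'))) (-‿inverseʳ q))
        difference-at : ∀ {f : Carrier → Carrier → Carrier} (i : Fin 4) →
          (∀ p q s t → place p q s t i ≈ f s t) → f s t - f s' t' ≈ 0#
        difference-at i place-i =
          trans (sym (+-cong (place-i p q s t) (-‿cong (place-i p q s' t')))) (difference≈0 i)

    once⇒trivialIntersection : ∀ {u v} → EachSymbolOnceIn R u v →
      TrivialIntersection u v direction₁ direction₂
    once⇒trivialIntersection {u} {v} once x x∈g (s , t , x∈directions) m =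
      trans (x∈directions m) (0x+0y≈0 (direction₁ m) (direction₂ m) s≈0 t≈0)
      where
      origin : SameSymbol u v (place 0# 0# 0# 0#) 0v
      origin = InSpan⇒SameSymbol-0v (InSpan-0v (≈v-by-coordinates
        (place-fixed₁ 0# 0# 0# 0#) (place-fixed₂ 0# 0# 0# 0#)
        (place-free₁ 0# 0# 0# 0#) (place-free₂ 0# 0# 0# 0#)))
      cell : SameSymbol u v (place 0# 0# s t) 0v
      cell = InSpan⇒SameSymbol-0v (InSpan-resp-≈v
        (λ m → trans (x∈directions m) (sym (in-directions s t
          (place-fixed₁ 0# 0# s t) (place-fixed₂ 0# 0# s t) (place-free₁ 0# 0# s t) (place-free₂ 0# 0# s t) m)))
        x∈g)
      s≈0 : s ≈ 0#
      s≈0 = proj₁ (ExactlyOne₂-unique (once 0v 0# 0#) cell origin)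
      t≈0 : t ≈ 0#
      t≈0 = proj₂ (ExactlyOne₂-unique (once 0v 0# 0#) cell origin)

    eachSymbolOnce⇔trivialIntersection : ∀ {u v} → LinIndep u v →
      EachSymbolOnceIn R u v ⇔ TrivialIntersection u v direction₁ direction₂
    eachSymbolOnce⇔trivialIntersection independent = mk⇔ once⇒trivialIntersection λ g∩directions y p q →
      let s , t , same = symbol-occurs g∩directions independent y p q in
      s , t , same , λ _ _ → symbol-unique g∩directions same

proposition2p1 : ∀ {c ℓ} (F : Field c ℓ) (q : ℕ) → let open FieldTheory F in
    HasOrder q → CharNot2 → (u v : V4) → LinIndep u v →
    (GeneratesSudoku u v ⇔
    (TrivialIntersection u v e₁ e₂ × TrivialIntersection u v e₃ e₄ × TrivialIntersection u v e₂ e₄))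
proposition2p1 F _ _ _ u v independent = mk⇔
  (λ (inRows , inColumns , inBoxes) → to columns inColumns , to rows inRows , to boxes inBoxes)
  (λ (gc , gr , gss) → from rows gr , from columns gc , from boxes gss)
  where
  open LinearSudoku F
  open module Once (R : Regions) = Equivalence (eachSymbolOnce⇔trivialIntersection R independent)
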